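{- If $L$ is a finite distributive lattice, then $D(L)\le 2$, and $D(L)=2$ if and only if $D(Q_L)>1$.
   Context: A point of a lattice is join-irreducible if in the Hasse diagram it has exactly one downward edge; $Q_L$ is the subposet induced by the join-irreducible points of $L$. A coloring of a poset is distinguishing if the only color-preserving automorphism is the identity; $D(P)$ is the least number of colors in a distinguishing coloring of $P$. -}

module Defs where

open import Level using (Level)
open import Data.Nat using (ℕ; _<_)
open import Data.Fin using (Fin)
open import Data.Product using (Σ; ∃; _×_; _,_)
open import Data.Refinement using (Refinement)
open import Function.Bundles using (_↔_; _⇔_; Inverse)
open import Relation.Binary.PropositionalEquality using (_≡_)
open import Relation.Nullary using (¬_)

private variable a ℓ : Level

module _ {A : Set a} (_≤_ : A → A → Set ℓ) where

  _<ₚ_ : A → A → Set _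
  x <ₚ y = x ≤ y × ¬ (x ≡ y)

  Covers : A → A → Set _
  Covers x y = x <ₚ y × (∀ z → ¬ (x <ₚ z × z <ₚ y))

  JoinIrreducible : A → Set _
  JoinIrreducible x = Σ A λ y → Covers y x × (∀ z → Covers z x → z ≡ y)

  record Automorphism : Set (a Level.⊔ ℓ) where
    field
      perm     : A ↔ A
      preserves : ∀ x y → (x ≤ y) ⇔ (Inverse.to perm x ≤ Inverse.to perm y)
  open Automorphism public

  Distinguishing : {k : ℕ} → (A → Fin k) → Set _
  Distinguishing c = ∀ (σ : Automorphism) →
    (∀ x → c (Inverse.to (perm σ) x) ≡ c x) → ∀ x → Inverse.to (perm σ) x ≡ x

  HasDistColoring : ℕ → Set _
  HasDistColoring k = Σ (A → Fin k) Distinguishing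

  IsD : ℕ → Set _
  IsD k = HasDistColoring k × (∀ m → m < k → ¬ HasDistColoring m)

  -- the subposet Q induced by the join-irreducible points (proof-irrelevant
  -- membership, so points of Q are determined by their underlying point)
  QCarrier : Set _
  QCarrier = Refinement A JoinIrreducible

  _≤Q_ : QCarrier → QCarrier → Set ℓ
  p ≤Q q = Refinement.value p ≤ Refinement.value q

module Submission where

-- Upper bound: color a maximal chain bot ⋖ … ⋖ top with one color and the
-- rest with the other.  An automorphism f preserving this maps the chain to
-- itself, hence fixes it pointwise.  If a join-irreducible q enters the chain
-- at y ⋖ x (q ⊑ x, q ⋢ y) then x = f q ∨ y, so q ⊑ f q as join-irreducibles
-- are join-prime; symmetrically f q ⊑ q.  Fixing all join-irreducibles, f is
-- the identity since every element is the join of those below it.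
-- Characterisation: restriction to Q and the Birkhoff extension
-- x ↦ ⋁ { φ q : q ⊑ x } identify Aut L with Aut Q, so L is rigid iff Q is,
-- and D = 1 means rigid (module CompareD).
-- Both D's exist since distinguishing colorings are decidable by finite search.

open import Defs
open import Data.Nat using (ℕ; zero; suc; z≤n; s≤s; _≤_; _<_)
open import Data.Nat.Properties using (_≤?_; _<?_; ≰⇒>; ≮⇒≥; ≤-antisym; n<1+n; m<1+n⇒m<n∨m≡n)
open import Data.Fin using (Fin; zero; suc) renaming (_≟_ to _F≟_)
open import Data.Fin.Properties using (any?; all?; ¬∀⟶∃¬)
open import Data.Fin.Induction using (po-wellFounded; po-noetherian)
open import Data.Product using (Σ; ∃; _×_; _,_; proj₁; proj₂)
open import Data.Sum using (inj₁; inj₂; _⊎_; [_,_]′)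
open import Data.Empty using (⊥; ⊥-elim)
open import Data.Unit using (⊤; tt)
open import Data.Vec using (Vec; []; _∷_; lookup; tabulate)
open import Data.Vec.Properties using (lookup∘tabulate)
open import Data.List using (List; []; _∷_)
open import Data.List.Membership.Propositional using (_∈_)
open import Data.List.Relation.Unary.Any using (here; there)
import Data.List.Membership.DecPropositional as DecMembership
open import Data.Refinement using (value; _,_; value-injective)
open import Data.Irrelevant as Irr using ([_])
open import Function using (flip; case_of_)
open import Function.Bundles using (_⇔_; Inverse; Equivalence; mk⇔; mk↔ₛ′)
open import Induction.WellFounded using (WellFounded; Acc; acc)
open import Relation.Binary.PropositionalEquality using (_≡_; refl; sym; trans; cong; subst; subst₂)
open import Relation.Binary.Lattice.Structures using (IsDistributiveLattice)
open import Relation.Nullary using (¬_; Dec; yes; no)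
open import Relation.Nullary.Decidable using (_×-dec_; _→-dec_; ¬?; decidable-stable; map′; recompute)

module OrderIso {A : Set} (_⊑_ : A → A → Set) where

  record IsOrderIso (f g : A → A) : Set where
    field
      inverseˡ : ∀ y → f (g y) ≡ y
      inverseʳ : ∀ x → g (f x) ≡ x
      f-mono   : ∀ {x y} → x ⊑ y → f x ⊑ f y
      g-mono   : ∀ {x y} → x ⊑ y → g x ⊑ g y
  open IsOrderIso public

  _⊏_ : A → A → Set
  _⊏_ = _<ₚ_ _⊑_

  inverse : ∀ {f g} → IsOrderIso f g → IsOrderIso g f
  inverse i = record
    { inverseˡ = inverseʳ i ; inverseʳ = inverseˡ i ; f-mono = g-mono i ; g-mono = f-mono i }

  fromAutomorphism : (σ : Automorphism _⊑_) → IsOrderIso (Inverse.to (perm σ)) (Inverse.from (perm σ))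
  fromAutomorphism σ = record
    { inverseˡ = Inverse.strictlyInverseˡ (perm σ)
    ; inverseʳ = Inverse.strictlyInverseʳ (perm σ)
    ; f-mono   = λ {x} {y} → Equivalence.to (preserves σ x y)
    ; g-mono   = λ {x} {y} x⊑y → Equivalence.from (preserves σ (from x) (from y))
        (subst₂ _⊑_ (sym (to∘from x)) (sym (to∘from y)) x⊑y) }
    where
    from = Inverse.from (perm σ)
    to∘from = Inverse.strictlyInverseˡ (perm σ)

  module _ {f g : A → A} (i : IsOrderIso f g) where

    f-reflects : ∀ {x y} → f x ⊑ f y → x ⊑ y
    f-reflects {x} {y} le = subst₂ _⊑_ (inverseʳ i x) (inverseʳ i y) (g-mono i le)

    toAutomorphism : Automorphism _⊑_
    toAutomorphism = record
      { perm = mk↔ₛ′ f g (inverseˡ i) (inverseʳ i)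
      ; preserves = λ x y → mk⇔ (f-mono i) f-reflects }

    f-injective : ∀ {x y} → f x ≡ f y → x ≡ y
    f-injective {x} {y} e = trans (sym (inverseʳ i x)) (trans (cong g e) (inverseʳ i y))

    f-strict : ∀ {x y} → x ⊏ y → f x ⊏ f y
    f-strict (le , ne) = f-mono i le , λ e → ne (f-injective e)

    f-strict⁻ : ∀ {x y} → f x ⊏ f y → x ⊏ y
    f-strict⁻ (le , ne) = f-reflects le , λ e → ne (cong f e)

    -- a point strictly between f x and f y is the image of a point
    -- strictly between x and y
    f-covers : ∀ {x y} → Covers _⊑_ x y → Covers _⊑_ (f x) (f y)
    f-covers {x} {y} (x⊏y , nothingBetween) = f-strict x⊏y , λ w (fx⊏w , w⊏fy) →
      nothingBetween (g w)
        ( f-strict⁻ (subst (f x ⊏_) (sym (inverseˡ i w)) fx⊏w)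
        , f-strict⁻ (subst (_⊏ f y) (sym (inverseˡ i w)) w⊏fy) )

  f-covers⁻ : ∀ {f g} → IsOrderIso f g → ∀ {x y} → Covers _⊑_ (f x) (f y) → Covers _⊑_ x y
  f-covers⁻ i {x} {y} c = subst₂ (Covers _⊑_) (inverseʳ i x) (inverseʳ i y) (f-covers (inverse i) c)

  f-joinIrreducible : ∀ {f g} → IsOrderIso f g → ∀ {q} → JoinIrreducible _⊑_ q → JoinIrreducible _⊑_ (f q)
  f-joinIrreducible {f} {g} i {q} (c , c⋖q , unique) = f c , f-covers i c⋖q , λ z z⋖fq →
    trans (sym (inverseˡ i z))
      (cong f (unique (g z) (f-covers⁻ i (subst (λ w → Covers _⊑_ w (f q)) (sym (inverseˡ i z)) z⋖fq))))

module LeastWitness (P : ℕ → Set) (P? : ∀ m → Dec (P m)) where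

  Least : ℕ → Set
  Least k = P k × (∀ m → m < k → ¬ P m)

  searchBelow : ∀ b → Σ ℕ Least ⊎ (∀ m → m < b → ¬ P m)
  searchBelow zero = inj₂ λ m ()
  searchBelow (suc b) with searchBelow b
  ... | inj₁ found = inj₁ found
  ... | inj₂ none with P? b
  ...   | yes pb = inj₁ (b , pb , none)
  ...   | no ¬pb = inj₂ λ m m<1+b → below-or-at (m<1+n⇒m<n∨m≡n m<1+b)
    where
    below-or-at : ∀ {m} → m < b ⊎ m ≡ b → ¬ P m
    below-or-at (inj₁ m<b) = none _ m<b
    below-or-at (inj₂ refl) = ¬pb

  leastWitness : ∀ b → P b → Σ ℕ Least
  leastWitness b pb with searchBelow (suc b)
  ... | inj₁ found = found
  ... | inj₂ none = ⊥-elim (none b (n<1+n b) pb)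

module Distinguishing {A : Set} (P : A → A → Set) where

  HD : ℕ → Set
  HD = HasDistColoring P

  Rigid : Set
  Rigid = ∀ (σ : Automorphism P) x → Inverse.to (perm σ) x ≡ x

  rigid⇒HD1 : Rigid → HD 1
  rigid⇒HD1 rigid = (λ _ → zero) , λ σ _ → rigid σ

  -- with at most one color every automorphism preserves the coloring
  HD≤1⇒rigid : ∀ {k} → HD k → k ≤ 1 → Rigid
  HD≤1⇒rigid {zero} (c , _) _ σ x with c x
  ... | ()
  HD≤1⇒rigid {suc zero} (c , dist) _ σ = dist σ λ x → one-color (c _) (c x)
    where
    one-color : (a b : Fin 1) → a ≡ b
    one-color zero zero = refl
  HD≤1⇒rigid {suc (suc k)} _ (s≤s ())

  injective⇒HD : ∀ {k} (c : A → Fin k) → (∀ {x y} → c x ≡ c y → x ≡ y) → HD k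
  injective⇒HD c inj = c , λ σ preserved x → inj (preserved x)

  empty⇒HD : (A → ⊥) → ∀ m → HD m
  empty⇒HD empty m = (λ x → ⊥-elim (empty x)) , λ σ _ x → ⊥-elim (empty x)

  IsD-minimal : ∀ {k m} → IsD P k → HD m → k ≤ m
  IsD-minimal {k} {m} (_ , fewer) hd with k ≤? m
  ... | yes k≤m = k≤m
  ... | no k≰m = ⊥-elim (fewer m (≰⇒> k≰m) hd)

  distinguishingNumber : (∀ m → Dec (HD m)) → ∀ {b} → HD b → Σ ℕ (IsD P)
  distinguishingNumber HD? {b} = LeastWitness.leastWitness HD HD? b

module CompareD {A B : Set} (P : A → A → Set) (Q : B → B → Set) where
  open Distinguishing using (HD; Rigid; rigid⇒HD1; HD≤1⇒rigid; IsD-minimal; distinguishingNumber)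

  compareD : (∀ m → Dec (HD P m)) → (∀ m → Dec (HD Q m)) →
    HD P 2 → ∀ {b} → HD Q b → (Rigid P ⇔ Rigid Q) →
    Σ ℕ (IsD P) × Σ ℕ (IsD Q) ×
    (∀ k → IsD P k → (k ≤ 2) × ((k ≡ 2) ⇔ (∀ m → IsD Q m → 1 < m)))
  compareD HDP? HDQ? HDP2 HDQb rigid⇔ =
    DP , DQ , λ k isD → IsD-minimal P isD HDP2 , mk⇔ (two⇒Q-nonrigid k isD) (Q-nonrigid⇒two k isD)
    where
    DP = distinguishingNumber P HDP? HDP2
    DQ = distinguishingNumber Q HDQ? HDQb

    two⇒Q-nonrigid : ∀ k → IsD P k → k ≡ 2 → ∀ m → IsD Q m → 1 < m
    two⇒Q-nonrigid k isD refl m isDQ with 1 <? m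
    ... | yes 1<m = 1<m
    ... | no 1≮m = ⊥-elim (proj₂ isD 1 (s≤s (s≤s z≤n))
            (rigid⇒HD1 P (Equivalence.from rigid⇔ (HD≤1⇒rigid Q (proj₁ isDQ) (≮⇒≥ 1≮m)))))

    Q-nonrigid⇒two : ∀ k → IsD P k → (∀ m → IsD Q m → 1 < m) → k ≡ 2
    Q-nonrigid⇒two k isD Q-nonrigid with k ≤? 1
    ... | yes k≤1 = ⊥-elim (proj₂ (proj₂ DQ) 1 (Q-nonrigid (proj₁ DQ) (proj₂ DQ))
            (rigid⇒HD1 Q (Equivalence.to rigid⇔ (HD≤1⇒rigid P (proj₁ isD) k≤1))))
    ... | no k≰1 = ≤-antisym (IsD-minimal P isD HDP2) (≰⇒> k≰1)

decΣVec : ∀ {m} k (P : Vec (Fin m) k → Set) → (∀ v → Dec (P v)) → Dec (Σ (Vec (Fin m) k) P)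
decΣVec zero P P? with P? []
... | yes p = yes ([] , p)
... | no ¬p = no λ { ([] , p) → ¬p p }
decΣVec (suc k) P P? with any? (λ a → decΣVec k (λ v → P (a ∷ v)) (λ v → P? (a ∷ v)))
... | yes (a , v , p) = yes (a ∷ v , p)
... | no ¬p = no λ { (a ∷ v , p) → ¬p (a , v , p) }

decΠVec : ∀ {m} k (P : Vec (Fin m) k → Set) → (∀ v → Dec (P v)) → Dec (∀ v → P v)
decΠVec zero P P? with P? []
... | yes p = yes λ { [] → p }
... | no ¬p = no λ all → ¬p (all [])
decΠVec (suc k) P P? with all? (λ a → decΠVec k (λ v → P (a ∷ v)) (λ v → P? (a ∷ v)))
... | yes all = yes λ { (a ∷ v) → all a v }
... | no ¬all = no λ all → ¬all (λ a v → all (a ∷ v))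

-- For a decidable relation on Fin N, automorphisms are self-maps satisfying
-- a decidable condition, so whether some coloring distinguishes the points of
-- a decidable subset P can be decided by enumerating colorings and maps as
-- vectors.
module FiniteSearch {N : ℕ} (_⊑_ : Fin N → Fin N → Set) (_⊑?_ : ∀ x y → Dec (x ⊑ y)) where

  IsAutMap : (Fin N → Fin N) → Set
  IsAutMap f = (∀ x y → x ⊑ y → f x ⊑ f y) × (∀ x y → f x ⊑ f y → x ⊑ y)
             × (∀ x y → f x ≡ f y → x ≡ y) × (∀ y → ∃ λ x → f x ≡ y)

  isAutMap? : ∀ f → Dec (IsAutMap f)
  isAutMap? f = all? (λ x → all? λ y → (x ⊑? y) →-dec (f x ⊑? f y))
         ×-dec all? (λ x → all? λ y → (f x ⊑? f y) →-dec (x ⊑? y))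
         ×-dec all? (λ x → all? λ y → (f x F≟ f y) →-dec (x F≟ y))
         ×-dec all? (λ y → any? λ x → f x F≟ y)

  isAutMap-respects : ∀ {f h} → (∀ x → f x ≡ h x) → IsAutMap f → IsAutMap h
  isAutMap-respects {f} {h} f≗h (mono , reflects , injective , surjective) =
      (λ x y le → subst₂ _⊑_ (f≗h x) (f≗h y) (mono x y le))
    , (λ x y le → reflects x y (subst₂ _⊑_ (sym (f≗h x)) (sym (f≗h y)) le))
    , (λ x y e → injective x y (trans (f≗h x) (trans e (sym (f≗h y)))))
    , λ y → proj₁ (surjective y) , trans (sym (f≗h _)) (proj₂ (surjective y))

  autMap⇒automorphism : ∀ {f} → IsAutMap f → Automorphism _⊑_
  autMap⇒automorphism {f} (mono , reflects , injective , surjective) = record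
    { perm = mk↔ₛ′ f (λ y → proj₁ (surjective y)) (λ y → proj₂ (surjective y))
                     (λ x → injective _ x (proj₂ (surjective (f x))))
    ; preserves = λ x y → mk⇔ (mono x y) (reflects x y) }

  automorphism⇒autMap : (σ : Automorphism _⊑_) → IsAutMap (Inverse.to (perm σ))
  automorphism⇒autMap σ = (λ x y → Equivalence.to (preserves σ x y)) , (λ x y → Equivalence.from (preserves σ x y))
             , (λ x y e → trans (sym (from∘to x)) (trans (cong from e) (from∘to y)))
             , λ y → from y , Inverse.strictlyInverseˡ (perm σ) y
    where
    from = Inverse.from (perm σ)
    from∘to = Inverse.strictlyInverseʳ (perm σ)

  DistinguishingOn : (Fin N → Set) → ∀ {m} → (Fin N → Fin m) → Set
  DistinguishingOn P c = ∀ (σ : Automorphism _⊑_) →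
    (∀ x → P x → c (Inverse.to (perm σ) x) ≡ c x) → ∀ x → P x → Inverse.to (perm σ) x ≡ x

  private
    DistinguishingVec : (Fin N → Set) → ℕ → Set
    DistinguishingVec P m = Σ (Vec (Fin m) N) λ cv → ∀ (fv : Vec (Fin N) N) → IsAutMap (lookup fv) →
      (∀ x → P x → lookup cv (lookup fv x) ≡ lookup cv x) → ∀ x → P x → lookup fv x ≡ x

    fromVec : ∀ {P m} → DistinguishingVec P m → Σ (Fin N → Fin m) (DistinguishingOn P)
    fromVec (cv , dist) = lookup cv , λ σ preserved x px →
      let f = Inverse.to (perm σ)
          f≗fv = λ y → sym (lookup∘tabulate f y)
      in trans (f≗fv x) (dist (tabulate f) (isAutMap-respects f≗fv (automorphism⇒autMap σ))
           (λ y py → trans (cong (lookup cv) (sym (f≗fv y))) (preserved y py)) x px)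

    toVec : ∀ {P m} → Σ (Fin N → Fin m) (DistinguishingOn P) → DistinguishingVec P m
    toVec (c , dist) = tabulate c , λ fv isAut preserved x px →
      dist (autMap⇒automorphism isAut)
        (λ y py → trans (sym (lookup∘tabulate c _)) (trans (preserved y py) (lookup∘tabulate c y))) x px

  distinguishingOn? : (P : Fin N → Set) → (∀ x → Dec (P x)) → ∀ m → Dec (Σ (Fin N → Fin m) (DistinguishingOn P))
  distinguishingOn? P P? m = map′ fromVec toVec
    (decΣVec N _ λ cv → decΠVec N _ λ fv → isAutMap? (lookup fv)
      →-dec (all? (λ x → P? x →-dec (lookup cv (lookup fv x) F≟ lookup cv x))
      →-dec all? (λ x → P? x →-dec (lookup fv x F≟ x))))

  HD? : ∀ m → Dec (HasDistColoring _⊑_ m)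
  HD? m = map′ (λ (c , dist) → c , λ σ preserved x → dist σ (λ y _ → preserved y) x tt)
               (λ (c , dist) → c , λ σ preserved x _ → dist σ (λ y → preserved y tt) x)
               (distinguishingOn? (λ _ → ⊤) (λ _ → yes tt) m)

module FiniteDistributiveLattice {n : ℕ} (_⊑_ : Fin (suc n) → Fin (suc n) → Set)
    (_∨_ _∧_ : Fin (suc n) → Fin (suc n) → Fin (suc n))
    (isDL : IsDistributiveLattice _≡_ _⊑_ _∨_ _∧_) where

  A : Set
  A = Fin (suc n)

  open IsDistributiveLattice isDL
    using (x≤x∨y; y≤x∨y; ∨-least; x∧y≤x; x∧y≤y; ∧-greatest; ∧-distribˡ-∨; isPartialOrder)
    renaming (refl to ⊑-refl; trans to ⊑-trans; antisym to ⊑-antisym)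
  open OrderIso _⊑_
  open DecMembership (_F≟_ {suc n}) using (_∈?_)

  _⋖_ : A → A → Set
  _⋖_ = Covers _⊑_

  JI : A → Set
  JI = JoinIrreducible _⊑_

  _⊑?_ : ∀ x y → Dec (x ⊑ y)
  x ⊑? y with (x ∨ y) F≟ y
  ... | yes e = yes (subst (x ⊑_) e (x≤x∨y x y))
  ... | no ne = no λ x⊑y → ne (⊑-antisym (∨-least x⊑y ⊑-refl) (y≤x∨y x y))

  _⊏?_ : ∀ x y → Dec (x ⊏ y)
  x ⊏? y = (x ⊑? y) ×-dec ¬? (x F≟ y)

  _⋖?_ : ∀ x y → Dec (x ⋖ y)
  x ⋖? y = (x ⊏? y) ×-dec all? (λ z → ¬? ((x ⊏? z) ×-dec (z ⊏? y)))

  JI? : ∀ x → Dec (JI x)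
  JI? x = any? (λ c → (c ⋖? x) ×-dec all? (λ z → (z ⋖? x) →-dec (z F≟ c)))

  ⊏-wellFounded : WellFounded _⊏_
  ⊏-wellFounded = po-wellFounded isPartialOrder

  ⊐-wellFounded : WellFounded (flip _⊏_)
  ⊐-wellFounded = po-noetherian isPartialOrder

  -- the meet of a nonempty finite family (the value for k = 0 is arbitrary)
  meetOf : ∀ k → (Fin k → A) → A
  meetOf zero _ = zero
  meetOf (suc k) g = g zero ∧ meetOf k (λ i → g (suc i))

  meetOf-lower : ∀ k g (i : Fin k) → meetOf k g ⊑ g i
  meetOf-lower (suc k) g zero = x∧y≤x _ _
  meetOf-lower (suc k) g (suc i) = ⊑-trans (x∧y≤y _ _) (meetOf-lower k _ i)

  bot : A
  bot = meetOf (suc n) (λ x → x)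

  bot-least : ∀ x → bot ⊑ x
  bot-least = meetOf-lower (suc n) (λ x → x)

  ⊑bot⇒≡bot : ∀ {x} → x ⊑ bot → x ≡ bot
  ⊑bot⇒≡bot le = ⊑-antisym le (bot-least _)

  bot⊏ : ∀ {x} → ¬ x ≡ bot → bot ⊏ x
  bot⊏ {x} x≢bot = bot-least x , λ e → x≢bot (sym e)

  ⋁ : ∀ {k} (P : Fin k → Set) → (∀ i → Dec (P i)) → (Fin k → A) → A
  ⋁ {zero} P P? g = bot
  ⋁ {suc k} P P? g with P? zero
  ... | yes _ = g zero ∨ ⋁ (λ i → P (suc i)) (λ i → P? (suc i)) (λ i → g (suc i))
  ... | no _ = ⋁ (λ i → P (suc i)) (λ i → P? (suc i)) (λ i → g (suc i))

  ⋁-upper : ∀ {k} P P? g (i : Fin k) → P i → g i ⊑ ⋁ P P? g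
  ⋁-upper {suc k} P P? g zero p with P? zero
  ... | yes _ = x≤x∨y _ _
  ... | no ¬p = ⊥-elim (¬p p)
  ⋁-upper {suc k} P P? g (suc i) p with P? zero
  ... | yes _ = ⊑-trans (⋁-upper _ _ _ i p) (y≤x∨y _ _)
  ... | no _ = ⋁-upper _ _ _ i p

  ⋁-least : ∀ {k} P P? (g : Fin k → A) y → (∀ i → P i → g i ⊑ y) → ⋁ P P? g ⊑ y
  ⋁-least {zero} P P? g y bound = bot-least y
  ⋁-least {suc k} P P? g y bound with P? zero
  ... | yes p = ∨-least (bound zero p) (⋁-least _ _ _ y λ i → bound (suc i))
  ... | no _ = ⋁-least _ _ _ y λ i → bound (suc i)

  top : A
  top = ⋁ (λ _ → ⊤) (λ _ → yes tt) (λ x → x)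

  top-greatest : ∀ x → x ⊑ top
  top-greatest x = ⋁-upper (λ _ → ⊤) (λ _ → yes tt) (λ x → x) x tt

  between : ∀ {x z} → x ⊏ z → ¬ x ⋖ z → ∃ λ w → x ⊏ w × w ⊏ z
  between {x} {z} x⊏z ¬x⋖z =
    let w , ¬¬between = ¬∀⟶∃¬ (suc n) (λ w → ¬ (x ⊏ w × w ⊏ z))
                           (λ w → ¬? ((x ⊏? w) ×-dec (w ⊏? z))) (λ none → ¬x⋖z (x⊏z , none))
    in w , decidable-stable ((x ⊏? w) ×-dec (w ⊏? z)) ¬¬between

  lowerCoverAbove : ∀ {x z} → z ⊏ x → ∃ λ c → c ⋖ x × z ⊑ c
  lowerCoverAbove {x} {z} = go z (⊐-wellFounded z)
    where
    go : ∀ z → Acc (flip _⊏_) z → z ⊏ x → ∃ λ c → c ⋖ x × z ⊑ c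
    go z (acc rec) z⊏x with z ⋖? x
    ... | yes z⋖x = z , z⋖x , ⊑-refl
    ... | no ¬z⋖x =
      let w , z⊏w , w⊏x = between z⊏x ¬z⋖x
          c , c⋖x , w⊑c = go w (rec z⊏w) w⊏x
      in c , c⋖x , ⊑-trans (proj₁ z⊏w) w⊑c

  upperCoverBelow : ∀ {x z} → x ⊏ z → ∃ λ c → x ⋖ c × c ⊑ z
  upperCoverBelow {x} {z} = go z (⊏-wellFounded z)
    where
    go : ∀ z → Acc _⊏_ z → x ⊏ z → ∃ λ c → x ⋖ c × c ⊑ z
    go z (acc rec) x⊏z with x ⋖? z
    ... | yes x⋖z = z , x⋖z , ⊑-refl
    ... | no ¬x⋖z =
      let w , x⊏w , w⊏z = between x⊏z ¬x⋖z
          c , x⋖c , c⊑w = go w (rec w⊏z) x⊏w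
      in c , x⋖c , ⊑-trans c⊑w (proj₁ w⊏z)

  coverJoin : ∀ {u y x} → y ⋖ x → u ⊑ x → ¬ u ⊑ y → (u ∨ y) ≡ x
  coverJoin {u} {y} {x} ((y⊑x , _) , nothingBetween) u⊑x u⋢y with (u ∨ y) F≟ x
  ... | yes e = e
  ... | no ne = ⊥-elim (nothingBetween (u ∨ y)
          ( (y≤x∨y u y , λ e → u⋢y (subst (u ⊑_) (sym e) (x≤x∨y u y)))
          , (∨-least u⊑x y⊑x , ne) ))

  distinctCoversJoin : ∀ {z c x} → z ⋖ x → c ⋖ x → ¬ z ≡ c → (z ∨ c) ≡ x
  distinctCoversJoin {z} {c} z⋖x c⋖x z≢c =
    coverJoin c⋖x (proj₁ (proj₁ z⋖x)) λ z⊑c → proj₂ z⋖x c ((z⊑c , z≢c) , proj₁ c⋖x)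

  anotherLowerCover : ∀ {c x} → c ⋖ x → ¬ JI x → ∃ λ z → z ⋖ x × ¬ z ≡ c
  anotherLowerCover {c} {x} c⋖x ¬ji
    with ¬∀⟶∃¬ (suc n) (λ z → z ⋖ x → z ≡ c) (λ z → (z ⋖? x) →-dec (z F≟ c)) (λ unique → ¬ji (c , c⋖x , unique))
  ... | z , ¬unique with z ⋖? x
  ...   | yes z⋖x = z , z⋖x , λ e → ¬unique (λ _ → e)
  ...   | no ¬z⋖x = ⊥-elim (¬unique λ z⋖x → ⊥-elim (¬z⋖x z⋖x))

  -- By induction on x: a
  -- non-bottom x is either join-irreducible or the join of two lower covers.
  ⊑-viaJoinIrreducibles : ∀ x y → (∀ q → JI q → q ⊑ x → q ⊑ y) → x ⊑ y
  ⊑-viaJoinIrreducibles x y = go x (⊏-wellFounded x)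
    where
    below : ∀ {c x} → c ⋖ x → (∀ q → JI q → q ⊑ x → q ⊑ y) → ∀ q → JI q → q ⊑ c → q ⊑ y
    below c⋖x bound q jq q⊑c = bound q jq (⊑-trans q⊑c (proj₁ (proj₁ c⋖x)))

    go : ∀ x → Acc _⊏_ x → (∀ q → JI q → q ⊑ x → q ⊑ y) → x ⊑ y
    go x (acc rec) bound with x F≟ bot
    ... | yes refl = bot-least y
    ... | no x≢bot with lowerCoverAbove (bot⊏ x≢bot) | JI? x
    ...   | _ | yes jx = bound x jx ⊑-refl
    ...   | c , c⋖x , _ | no ¬jx =
      let z , z⋖x , z≢c = anotherLowerCover c⋖x ¬jx
          z⊑y = go z (rec (proj₁ z⋖x)) (below z⋖x bound)
          c⊑y = go c (rec (proj₁ c⋖x)) (below c⋖x bound)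
      in subst (_⊑ y) (distinctCoversJoin z⋖x c⋖x z≢c) (∨-least z⊑y c⊑y)

  ⊏JI⇒⊑cover : ∀ {q w} → (jq : JI q) → w ⊏ q → w ⊑ proj₁ jq
  ⊏JI⇒⊑cover (c , _ , unique) w⊏q with lowerCoverAbove w⊏q
  ... | c' , c'⋖q , w⊑c' = subst (_ ⊑_) (unique c' c'⋖q) w⊑c'

  JI≢bot : ∀ {q} → JI q → ¬ q ≡ bot
  JI≢bot (c , ((c⊑q , c≢q) , _) , _) refl = c≢q (⊑bot⇒≡bot c⊑q)

  -- Distributivity makes join-irreducibles join-prime: if q ⊑ a ∨ b with q
  -- below neither, then q = (q ∧ a) ∨ (q ∧ b) lies below the lower cover of q.
  joinPrime : ∀ {q a b} → JI q → q ⊑ (a ∨ b) → q ⊑ a ⊎ q ⊑ b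
  joinPrime {q} {a} {b} jq q⊑a∨b with q ⊑? a | q ⊑? b
  ... | yes q⊑a | _ = inj₁ q⊑a
  ... | no _ | yes q⊑b = inj₂ q⊑b
  ... | no q⋢a | no q⋢b = ⊥-elim (c≢q (⊑-antisym c⊑q q⊑c))
    where
    c⊑q : proj₁ jq ⊑ q
    c⊑q = proj₁ (proj₁ (proj₁ (proj₂ jq)))

    c≢q : ¬ proj₁ jq ≡ q
    c≢q = proj₂ (proj₁ (proj₁ (proj₂ jq)))

    meet⊏ : ∀ {d} → ¬ q ⊑ d → (q ∧ d) ⊏ q
    meet⊏ {d} q⋢d = x∧y≤x q d , λ e → q⋢d (subst (_⊑ d) e (x∧y≤y q d))

    q≡joinOfMeets : q ≡ ((q ∧ a) ∨ (q ∧ b))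
    q≡joinOfMeets = trans (⊑-antisym (∧-greatest ⊑-refl q⊑a∨b) (x∧y≤x q (a ∨ b))) (∧-distribˡ-∨ q a b)

    q⊑c : q ⊑ proj₁ jq
    q⊑c = subst (_⊑ proj₁ jq) (sym q≡joinOfMeets) (∨-least (⊏JI⇒⊑cover jq (meet⊏ q⋢a)) (⊏JI⇒⊑cover jq (meet⊏ q⋢b)))

  ⋁-prime : ∀ {k p} P P? (g : Fin k → A) → JI p → p ⊑ ⋁ P P? g → ∃ λ i → P i × p ⊑ g i
  ⋁-prime {zero} P P? g jp p⊑bot = ⊥-elim (JI≢bot jp (⊑bot⇒≡bot p⊑bot))
  ⋁-prime {suc k} P P? g jp p⊑⋁ with P? zero
  ... | no _ = let i , pi , p⊑gi = ⋁-prime _ _ _ jp p⊑⋁ in suc i , pi , p⊑gi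
  ... | yes p0 with joinPrime jp p⊑⋁
  ...   | inj₁ p⊑g0 = zero , p0 , p⊑g0
  ...   | inj₂ p⊑rest = let i , pi , p⊑gi = ⋁-prime _ _ _ jp p⊑rest in suc i , pi , p⊑gi

  isoFixesBot : ∀ {f g} → IsOrderIso f g → f bot ≡ bot
  isoFixesBot {f} {g} i = ⊑bot⇒≡bot (subst (f bot ⊑_) (inverseˡ i bot) (f-mono i (bot-least (g bot))))

  fixesJI⇒identity : ∀ {f g} → IsOrderIso f g → (∀ q → JI q → f q ≡ q) → ∀ x → f x ≡ x
  fixesJI⇒identity {f} {g} i fixes x = ⊑-antisym
    (⊑-viaJoinIrreducibles (f x) x λ q jq q⊑fx →
      subst₂ _⊑_ (g-fixes q jq) (inverseʳ i x) (g-mono i q⊑fx))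
    (⊑-viaJoinIrreducibles x (f x) λ q jq q⊑x → subst (_⊑ f x) (fixes q jq) (f-mono i q⊑x))
    where
    g-fixes : ∀ q → JI q → g q ≡ q
    g-fixes q jq = trans (cong g (sym (fixes q jq))) (inverseʳ i q)

  comparableCovers : ∀ {y a b} → y ⋖ a → y ⋖ b → a ⊑ b ⊎ b ⊑ a → a ≡ b
  comparableCovers {y} {a} {b} y⋖a y⋖b (inj₁ a⊑b) with a F≟ b
  ... | yes a≡b = a≡b
  ... | no a≢b = ⊥-elim (proj₂ y⋖b a (proj₁ y⋖a , (a⊑b , a≢b)))
  comparableCovers y⋖a y⋖b (inj₂ b⊑a) = sym (comparableCovers y⋖b y⋖a (inj₁ b⊑a))

  next : ∀ x → ¬ x ≡ top → A
  next x x≢top = proj₁ (upperCoverBelow (top-greatest x , x≢top))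

  ⋖next : ∀ x x≢top → x ⋖ next x x≢top
  ⋖next x x≢top = proj₁ (proj₂ (upperCoverBelow (top-greatest x , x≢top)))

  ⊏next : ∀ x x≢top → x ⊏ next x x≢top
  ⊏next x x≢top = proj₁ (⋖next x x≢top)

  chainFrom : ∀ {x} → Acc (flip _⊏_) x → List A
  chainFrom {x} (acc rec) with x F≟ top
  ... | yes _ = x ∷ []
  ... | no x≢top = x ∷ chainFrom (rec (⊏next x x≢top))

  chain-top : ∀ {x} (ac : Acc (flip _⊏_) x) → top ∈ chainFrom ac
  chain-top {x} (acc rec) with x F≟ top
  ... | yes x≡top = here (sym x≡top)
  ... | no x≢top = there (chain-top (rec (⊏next x x≢top)))

  chain-above : ∀ {x} (ac : Acc (flip _⊏_) x) {e} → e ∈ chainFrom ac → x ⊑ e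
  chain-above {x} (acc rec) e∈ with x F≟ top
  chain-above (acc rec) (here refl) | yes _ = ⊑-refl
  chain-above (acc rec) (here refl) | no _ = ⊑-refl
  chain-above {x} (acc rec) (there e∈) | no x≢top =
    ⊑-trans (proj₁ (⊏next x x≢top)) (chain-above (rec (⊏next x x≢top)) e∈)

  chain-comparable : ∀ {x} (ac : Acc (flip _⊏_) x) {e e'} →
    e ∈ chainFrom ac → e' ∈ chainFrom ac → e ⊑ e' ⊎ e' ⊑ e
  chain-comparable {x} (acc rec) e∈ e'∈ with x F≟ top
  chain-comparable (acc rec) (here refl) (here refl) | yes _ = inj₁ ⊑-refl
  chain-comparable (acc rec) (here refl) (here refl) | no _ = inj₁ ⊑-refl
  chain-comparable {x} (acc rec) (here refl) (there e'∈) | no x≢top =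
    inj₁ (⊑-trans (proj₁ (⊏next x x≢top)) (chain-above (rec (⊏next x x≢top)) e'∈))
  chain-comparable {x} (acc rec) (there e∈) (here refl) | no x≢top =
    inj₂ (⊑-trans (proj₁ (⊏next x x≢top)) (chain-above (rec (⊏next x x≢top)) e∈))
  chain-comparable {x} (acc rec) (there e∈) (there e'∈) | no x≢top =
    chain-comparable (rec (⊏next x x≢top)) e∈ e'∈

  chain-predecessor : ∀ {x} (ac : Acc (flip _⊏_) x) {e} → e ∈ chainFrom ac → ¬ e ≡ x →
    ∃ λ y → y ∈ chainFrom ac × y ⋖ e
  chain-predecessor {x} (acc rec) e∈ e≢x with x F≟ top
  chain-predecessor (acc rec) (here refl) e≢x | yes _ = ⊥-elim (e≢x refl)
  chain-predecessor (acc rec) (here refl) e≢x | no _ = ⊥-elim (e≢x refl)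
  chain-predecessor {x} (acc rec) {e} (there e∈) e≢x | no x≢top with e F≟ next x x≢top
  ... | yes refl = x , here refl , ⋖next x x≢top
  ... | no e≢next =
    let y , y∈ , y⋖e = chain-predecessor (rec (⊏next x x≢top)) e∈ e≢next in y , there y∈ , y⋖e

  chainAcc : Acc (flip _⊏_) bot
  chainAcc = ⊐-wellFounded bot

  chain : List A
  chain = chainFrom chainAcc

  InChain : A → Set
  InChain e = e ∈ chain

  -- An automorphism mapping the chain into itself fixes it pointwise: by
  -- induction along the chain, f e and e are comparable upper covers of the
  -- predecessor of e, which f fixes.
  preservesChain⇒fixesChain : ∀ {f g} → IsOrderIso f g → (∀ e → InChain e → InChain (f e)) →
    ∀ e → InChain e → f e ≡ e
  preservesChain⇒fixesChain {f} i preserves e = go e (⊏-wellFounded e)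
    where
    go : ∀ e → Acc _⊏_ e → InChain e → f e ≡ e
    go e (acc rec) e∈ with e F≟ bot
    ... | yes refl = isoFixesBot i
    ... | no e≢bot =
      let y , y∈ , y⋖e = chain-predecessor chainAcc e∈ e≢bot
          y⋖fe = subst (_⋖ f e) (go y (rec (proj₁ y⋖e)) y∈) (f-covers i y⋖e)
      in comparableCovers y⋖fe y⋖e (chain-comparable chainAcc (preserves e e∈) e∈)

  ChainEntry : A → Set
  ChainEntry q = Σ A λ y → Σ A λ x → InChain y × InChain x × y ⋖ x × q ⊑ x × ¬ q ⊑ y

  -- descending the chain from top, a join-irreducible (≠ bot) must enter it
  chainEntry : ∀ {q} → JI q → ChainEntry q
  chainEntry {q} jq = go top (⊏-wellFounded top) (chain-top chainAcc) (top-greatest q)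
    where
    go : ∀ x → Acc _⊏_ x → InChain x → q ⊑ x → ChainEntry q
    go x (acc rec) x∈ q⊑x with x F≟ bot
    ... | yes refl = ⊥-elim (JI≢bot jq (⊑bot⇒≡bot q⊑x))
    ... | no x≢bot with chain-predecessor chainAcc x∈ x≢bot
    ...   | y , y∈ , y⋖x with q ⊑? y
    ...     | yes q⊑y = go y (rec (proj₁ y⋖x)) y∈ q⊑y
    ...     | no q⋢y = y , x , y∈ , x∈ , y⋖x , q⊑x , q⋢y

  -- If f fixes the chain then q ⊑ f q for join-irreducible q: at the entry
  -- step y ⋖ x of q we get x = f q ∨ y, and q is join-prime.
  fixesChain⇒JI⊑image : ∀ {f g} → IsOrderIso f g → (∀ e → InChain e → f e ≡ e) → ∀ q → JI q → q ⊑ f q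
  fixesChain⇒JI⊑image {f} i fixes q jq = fromEntry (chainEntry jq)
    where
    fromEntry : ChainEntry q → q ⊑ f q
    fromEntry (y , x , y∈ , x∈ , y⋖x , q⊑x , q⋢y) =
      [ (λ q⊑fq → q⊑fq) , (λ q⊑y → ⊥-elim (q⋢y q⊑y)) ]′ (joinPrime jq (subst (q ⊑_) (sym x≡fq∨y) q⊑x))
      where
      fq⊑x : f q ⊑ x
      fq⊑x = subst (f q ⊑_) (fixes x x∈) (f-mono i q⊑x)

      fq⋢y : ¬ f q ⊑ y
      fq⋢y fq⊑y = q⋢y (f-reflects i (subst (f q ⊑_) (sym (fixes y y∈)) fq⊑y))

      x≡fq∨y : (f q ∨ y) ≡ x
      x≡fq∨y = coverJoin y⋖x fq⊑x fq⋢y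

  -- applying this to f and to its inverse shows that f fixes every
  -- join-irreducible, hence everything
  fixesChain⇒identity : ∀ {f g} → IsOrderIso f g → (∀ e → InChain e → f e ≡ e) → ∀ x → f x ≡ x
  fixesChain⇒identity {f} {g} i fixes = fixesJI⇒identity i λ q jq →
    ⊑-antisym (subst (f q ⊑_) (inverseˡ i q) (f-mono i (fixesChain⇒JI⊑image (inverse i) g-fixes q jq)))
              (fixesChain⇒JI⊑image i fixes q jq)
    where
    g-fixes : ∀ e → InChain e → g e ≡ e
    g-fixes e e∈ = trans (cong g (sym (fixes e e∈))) (inverseʳ i e)

  -- Coloring the maximal chain with one color and the rest with the other
  -- is distinguishing: an automorphism preserving it maps the chain to itself.
  chainColoring : A → Fin 2
  chainColoring x with x ∈? chain
  ... | yes _ = suc zero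
  ... | no _ = zero

  chainColoring-inChain : ∀ x → InChain x → chainColoring x ≡ suc zero
  chainColoring-inChain x x∈ with x ∈? chain
  ... | yes _ = refl
  ... | no x∉ = ⊥-elim (x∉ x∈)

  chainColoring-colored : ∀ x → chainColoring x ≡ suc zero → InChain x
  chainColoring-colored x colored with x ∈? chain
  ... | yes x∈ = x∈
  chainColoring-colored x () | no _

  chainColoring-distinguishing : HasDistColoring _⊑_ 2
  chainColoring-distinguishing = chainColoring , λ σ preserved →
    let i = fromAutomorphism σ
    in fixesChain⇒identity i (preservesChain⇒fixesChain i λ e e∈ →
         chainColoring-colored _ (trans (preserved e) (chainColoring-inChain e e∈)))

  Q : Set
  Q = QCarrier _⊑_

  module QIso = OrderIso (_≤Q_ _⊑_)
  open Distinguishing using (Rigid)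
  open FiniteSearch _⊑_ _⊑?_ using (DistinguishingOn; distinguishingOn?)

  jiOf : (p : Q) → JI (value p)
  jiOf (x , [ jx ]) = recompute (JI? x) jx

  toQ : ∀ {x} → JI x → Q
  toQ {x} jx = x , [ jx ]

  onQ : ∀ {f g} → IsOrderIso f g → Q → Q
  onQ {f} i (x , jx) = f x , Irr.map (f-joinIrreducible i) jx

  restrict : ∀ {f g} (i : IsOrderIso f g) → QIso.IsOrderIso (onQ i) (onQ (inverse i))
  restrict i = record
    { inverseˡ = λ p → value-injective (inverseˡ i (value p))
    ; inverseʳ = λ p → value-injective (inverseʳ i (value p))
    ; f-mono = f-mono i
    ; g-mono = g-mono i }

  onJI : ∀ {B : Set} → (Q → B) → (A → B) → A → B
  onJI h default x with JI? x
  ... | yes jx = h (toQ jx)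
  ... | no _ = default x

  onJI-onQ : ∀ {B : Set} (h : Q → B) default (p : Q) → onJI h default (value p) ≡ h p
  onJI-onQ h default p with JI? (value p)
  ... | yes _ = refl
  ... | no ¬jp = ⊥-elim (¬jp (jiOf p))

  -- The extension of φ : Q → Q to L (Birkhoff's representation):
  -- x ↦ ⋁ { φ q : q join-irreducible, q ⊑ x }.
  JIBelow : A → A → Set
  JIBelow x q = JI q × q ⊑ x

  JIBelow? : ∀ x q → Dec (JIBelow x q)
  JIBelow? x q = JI? q ×-dec q ⊑? x

  liftQ : (Q → Q) → A → A
  liftQ φ = onJI (λ q → value (φ q)) (λ y → y)

  extend : (Q → Q) → A → A
  extend φ x = ⋁ (JIBelow x) (JIBelow? x) (liftQ φ)

  module _ {φ ψ : Q → Q} (b : QIso.IsOrderIso φ ψ) where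

    -- for p in Q: p ⊑ extend φ x exactly when ψ p ⊑ x, using join-primeness
    ⊑extend⇒ : ∀ (p : Q) x → value p ⊑ extend φ x → value (ψ p) ⊑ x
    ⊑extend⇒ p x p⊑ext with ⋁-prime (JIBelow x) (JIBelow? x) (liftQ φ) (jiOf p) p⊑ext
    ... | q , (jq , q⊑x) , p⊑liftq =
      let p⊑φq = subst (value p ⊑_) (onJI-onQ _ _ (toQ jq)) p⊑liftq
      in ⊑-trans (subst (λ r → value (ψ p) ⊑ value r) (QIso.inverseʳ b (toQ jq)) (QIso.g-mono b p⊑φq)) q⊑x

    ⇒⊑extend : ∀ (p : Q) x → value (ψ p) ⊑ x → value p ⊑ extend φ x
    ⇒⊑extend p x ψp⊑x =
      subst (_⊑ extend φ x) (trans (onJI-onQ _ _ (ψ p)) (cong value (QIso.inverseˡ b p)))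
        (⋁-upper (JIBelow x) (JIBelow? x) (liftQ φ) (value (ψ p)) (jiOf (ψ p) , ψp⊑x))

    extend-mono : ∀ {x y} → x ⊑ y → extend φ x ⊑ extend φ y
    extend-mono {x} {y} x⊑y = ⋁-least (JIBelow x) (JIBelow? x) (liftQ φ) _ λ q (jq , q⊑x) →
      ⋁-upper (JIBelow y) (JIBelow? y) (liftQ φ) q (jq , ⊑-trans q⊑x x⊑y)

    extend-agrees : ∀ (p : Q) → extend φ (value p) ≡ value (φ p)
    extend-agrees p = ⊑-antisym
      (⋁-least (JIBelow (value p)) (JIBelow? (value p)) (liftQ φ) _ λ q (jq , q⊑p) →
        subst (_⊑ value (φ p)) (sym (onJI-onQ _ _ (toQ jq))) (QIso.f-mono b q⊑p))
      (subst (_⊑ extend φ (value p)) (onJI-onQ _ _ p)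
        (⋁-upper (JIBelow (value p)) (JIBelow? (value p)) (liftQ φ) (value p) (jiOf p , ⊑-refl)))

  -- extend ψ inverts extend φ: compare both sides on join-irreducibles
  extend-inverse : ∀ {φ ψ} (b : QIso.IsOrderIso φ ψ) y → extend φ (extend ψ y) ≡ y
  extend-inverse {φ} {ψ} b y = ⊑-antisym
    (⊑-viaJoinIrreducibles _ _ λ r jr r⊑ →
      subst (_⊑ y) (cong value (QIso.inverseˡ b (toQ jr)))
        (⊑extend⇒ (QIso.inverse b) (ψ (toQ jr)) y (⊑extend⇒ b (toQ jr) (extend ψ y) r⊑)))
    (⊑-viaJoinIrreducibles _ _ λ r jr r⊑y →
      ⇒⊑extend b (toQ jr) (extend ψ y)
        (⇒⊑extend (QIso.inverse b) (ψ (toQ jr)) y (subst (_⊑ y) (sym (cong value (QIso.inverseˡ b (toQ jr)))) r⊑y)))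

  extendIso : ∀ {φ ψ} (b : QIso.IsOrderIso φ ψ) → IsOrderIso (extend φ) (extend ψ)
  extendIso b = record
    { inverseˡ = extend-inverse b
    ; inverseʳ = extend-inverse (QIso.inverse b)
    ; f-mono = extend-mono b
    ; g-mono = extend-mono (QIso.inverse b) }

  rigidQ⇒rigidL : Rigid (_≤Q_ _⊑_) → Rigid _⊑_
  rigidQ⇒rigidL rigidQ σ = fixesJI⇒identity i λ q jq →
    cong value (rigidQ (QIso.toAutomorphism (restrict i)) (toQ jq))
    where i = fromAutomorphism σ

  rigidL⇒rigidQ : Rigid _⊑_ → Rigid (_≤Q_ _⊑_)
  rigidL⇒rigidQ rigidL τ p =
    value-injective (trans (sym (extend-agrees b p)) (rigidL (toAutomorphism (extendIso b)) (value p)))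
    where b = QIso.fromAutomorphism τ

  -- Since Aut Q is Aut L acting on Q, distinguishing colorings of Q are the
  -- colorings of L distinguishing the join-irreducibles; hence decidable.
  HDQ⇒distinguishingOnJI : ∀ {m} → HasDistColoring (_≤Q_ _⊑_) (suc m) → Σ (A → Fin (suc m)) (DistinguishingOn JI)
  HDQ⇒distinguishingOnJI {m} (cQ , dist) = c , λ σ preserved x jx →
    let i = fromAutomorphism σ
    in cong value (dist (QIso.toAutomorphism (restrict i))
         (λ p → trans (sym (onJI-onQ cQ _ (onQ i p))) (trans (preserved (value p) (jiOf p)) (onJI-onQ cQ _ p)))
         (toQ jx))
    where
    c : A → Fin (suc m)
    c = onJI cQ (λ _ → zero)

  distinguishingOnJI⇒HDQ : ∀ {m} → Σ (A → Fin m) (DistinguishingOn JI) → HasDistColoring (_≤Q_ _⊑_) m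
  distinguishingOnJI⇒HDQ (c , dist) = (λ p → c (value p)) , λ τ preserved p →
    let b = QIso.fromAutomorphism τ
    in value-injective (trans (sym (extend-agrees b p))
         (dist (toAutomorphism (extendIso b))
           (λ x jx → trans (cong c (extend-agrees b (toQ jx))) (preserved (toQ jx))) (value p) (jiOf p)))

  -- with no colors at all only an empty Q can be colored
  HDQ? : ∀ m → Dec (HasDistColoring (_≤Q_ _⊑_) m)
  HDQ? zero with all? (λ x → ¬? (JI? x))
  ... | yes noJI = yes (Distinguishing.empty⇒HD (_≤Q_ _⊑_) (λ p → noJI (value p) (jiOf p)) zero)
  ... | no someJI = no λ (c , _) → someJI λ x jx → case c (toQ jx) of λ ()
  HDQ? (suc m) = map′ distinguishingOnJI⇒HDQ HDQ⇒distinguishingOnJI (distinguishingOn? JI JI? (suc m))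

open Distinguishing using (empty⇒HD; injective⇒HD)
open CompareD using (compareD)

theorem3p8 : (n : ℕ) (_⊑_ : Fin n → Fin n → Set) (_∨_ _∧_ : Fin n → Fin n → Fin n) →
    IsDistributiveLattice _≡_ _⊑_ _∨_ _∧_ →
    Σ ℕ (IsD _⊑_) × Σ ℕ (IsD (_≤Q_ _⊑_)) ×
    (∀ k → IsD _⊑_ k →
      (k ≤ 2) × ((k ≡ 2) ⇔ (∀ m → IsD (_≤Q_ _⊑_) m → 1 < m)))
-- For the empty lattice every coloring of L and of Q is distinguishing; for
-- a nonempty one the lattice facts above feed CompareD, with the injective
-- coloring of Q by its underlying points bounding D(Q).
theorem3p8 zero _⊑_ _ _ _ =
  compareD _⊑_ (_≤Q_ _⊑_) (λ m → yes (HDL m)) (λ m → yes (HDQ m)) (HDL 2) (HDQ 0)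
    (mk⇔ (λ _ _ p → ⊥-elim (noPoint (value p))) (λ _ _ x → ⊥-elim (noPoint x)))
  where
  noPoint : Fin 0 → ⊥
  noPoint ()

  HDL : ∀ m → HasDistColoring _⊑_ m
  HDL = empty⇒HD _⊑_ noPoint

  HDQ : ∀ m → HasDistColoring (_≤Q_ _⊑_) m
  HDQ = empty⇒HD (_≤Q_ _⊑_) (λ p → noPoint (value p))
theorem3p8 (suc n) _⊑_ _∨_ _∧_ isDL =
  compareD _⊑_ (_≤Q_ _⊑_) (FiniteSearch.HD? _⊑_ _⊑?_) HDQ?
    chainColoring-distinguishing
    (injective⇒HD (_≤Q_ _⊑_) value value-injective)
    (mk⇔ rigidL⇒rigidQ rigidQ⇒rigidL)
  where open FiniteDistributiveLattice _⊑_ _∨_ _∧_ isDL
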